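{- For every integer $n \ge 3$, the optimal pegging number of the cycle $C_n$ is $p(C_n)=\lceil n/2\rceil$.
   Context: $C_n$ is the cycle on $n$ vertices. A distribution of pegs on a graph $G$ is a subset $D \subseteq V(G)$. If $u,v \in D$ are distinct adjacent vertices and $w \notin D$ is a vertex adjacent to $v$, the pegging move (jumping $u$ over $v$ into $w$) replaces $D$ by $(D\setminus\{u,v\})\cup\{w\}$. A vertex $t$ is reachable from $D$ if some finite (possibly empty) sequence of pegging moves starting from $D$ ends in a distribution containing $t$; $\mathrm{Reach}(D)$ is the set of reachable vertices. The optimal pegging number $p(G)$ is the smallest positive integer $d$ such that some distribution of size $d$ on $G$ has reach $V(G)$. -}

module Defs where

open import Data.Nat using (ℕ; suc; _<_; _≤_; ⌈_/2⌉)
open import Data.Fin using (Fin; toℕ)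
open import Data.Fin.Subset using (Subset; _∈_; _∉_; ∣_∣; inside; outside)
open import Data.Vec using (_[_]≔_)
open import Data.Product using (Σ; _×_; ∃)
open import Data.Sum using (_⊎_)
open import Relation.Nullary using (¬_)
open import Relation.Binary.PropositionalEquality using (_≡_)
open import Relation.Binary.Construct.Closure.ReflexiveTransitive using (Star)

record Graph : Set₁ where
  field
    size : ℕ
    Adj  : Fin size → Fin size → Set

open Graph public

-- Successor relation on the cycle: j ≡ i+1 (mod n), written without _%_:
-- j = i+1, or i = n-1 and j = 0.
CycSucc : (n : ℕ) → Fin n → Fin n → Set
CycSucc n i j = (toℕ j ≡ suc (toℕ i)) ⊎ ((suc (toℕ i) ≡ n) × (toℕ j ≡ 0))

-- The cycle C_n on vertices 0,…,n-1: i ~ j iff j ≡ i+1 (mod n) or i ≡ j+1 (mod n).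
-- (Used only for n ≥ 3, where this is the usual simple cycle.)
Cycle : (n : ℕ) → Graph
Cycle n = record
  { size = n
  ; Adj  = λ i j → CycSucc n i j ⊎ CycSucc n j i
  }

Distribution : Graph → Set
Distribution G = Subset (size G)

data PegMove (G : Graph) : Distribution G → Distribution G → Set where
  jump : ∀ {D} (u v w : Fin (size G)) →
         u ∈ D → v ∈ D → ¬ (u ≡ v) → Adj G u v →
         w ∉ D → Adj G v w →
         PegMove G D (((D [ u ]≔ outside) [ v ]≔ outside) [ w ]≔ inside)

PegMoves : (G : Graph) → Distribution G → Distribution G → Set
PegMoves G = Star (PegMove G)

Reachable : (G : Graph) → Distribution G → Fin (size G) → Set
Reachable G D t = ∃ λ D' → PegMoves G D D' × t ∈ D'

ReachesAll : (G : Graph) → Distribution G → Set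
ReachesAll G D = ∀ t → Reachable G D t

Solvable : (G : Graph) → ℕ → Set
Solvable G d = Σ (Distribution G) λ D → (∣ D ∣ ≡ d) × ReachesAll G D

OptimalPeggingNumber : Graph → ℕ → Set
OptimalPeggingNumber G d =
  (1 ≤ d) × Solvable G d × (∀ d' → 1 ≤ d' → d' < d → ¬ Solvable G d')

module Submission where

-- A jump moves a peg two steps along the cycle, over a peg, onto a hole. Hence a vertex x
-- reachable from D already carries a peg, or D has pegs at x−1, x−3, …, x−(2k+1) and
-- x−(2k+2) for some k, or the mirror image of this holds on the other side of x; and this
-- property is invariant when we go backwards along a move. If every vertex has it, send each
-- hole to the neighbouring peg on the side of such a chain (the left one when possible): no
-- peg is hit twice, so n ≤ 2|D|. Conversely, pegs at 0 and at the odd vertices other than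
-- n−1 suffice: the peg at 0 sweeps over the odd pegs onto every even vertex, and n−1 is
-- reached by jumping the peg at 1 over 0.

open import Defs
open import Data.Nat
  using (ℕ; zero; suc; _+_; _∸_; _≤_; _<_; _≥_; _≤?_; _<?_; z≤n; s≤s; ⌊_/2⌋; ⌈_/2⌉)
open import Data.Nat.Properties
  using ( ≤-reflexive; ≤-pred; ≤-antisym; <-irrefl; <⇒≱; ≮⇒≥; suc-injective; +-monoʳ-≤; m≤n+m∸n
        ; ⌈n/2⌉-mono; n≡⌈n+n/2⌉; module ≤-Reasoning)
open import Data.Fin using (Fin; zero; suc; toℕ; inject₁; _≟_)
import Data.Fin.Properties as Fin
open import Data.Fin.Properties using (toℕ<n; toℕ-inject₁; sequence)
open import Data.Fin.Subset using (Subset; _⊂_; _∈_; _∉_; ∣_∣; inside; outside; ∁; _-_)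
open import Data.Fin.Subset.Properties
  using ( nonempty?; Empty-unique; ∣⊥∣≡0; p─⊥≡p; p─q⊆p; x∈p⇒p-x⊂p; x∈p∧x≢y⇒x∈p-y
        ; x∈∁p⇒x∉p; ∣∁p∣≡n∸∣p∣)
open import Data.Fin.Subset.Induction using (Acc; acc; ⊂-wellFounded)
open import Data.Vec using ([]; _∷_; lookup; _[_]≔_; here; there)
open import Data.Vec.Properties
  using ([]≔-updates; []=-injective; []=⇒lookup; lookup⇒[]=; lookup∘update′)
open import Data.Product using (∃; _×_; _,_)
open import Data.Sum using (_⊎_; inj₁; inj₂; [_,_]′)
open import Data.Empty using (⊥-elim)
open import Effect.Monad using (RawMonad)
open import Function using (id; _∘_; flip)
open import Relation.Nullary using (¬_; Dec; yes; no; contradiction)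
open import Relation.Nullary.Decidable using (decidable-stable; ¬¬-excluded-middle)
open import Relation.Nullary.Negation using (¬¬-Monad; ¬¬-map)
open import Relation.Binary.PropositionalEquality
  using (_≡_; _≢_; ≢-sym; refl; sym; trans; cong; subst; module ≡-Reasoning)
open import Relation.Binary.Construct.Closure.ReflexiveTransitive using (ε; _◅_; _◅◅_)
open import Relation.Binary.Rewriting using (Deterministic)

∣p∣≡1+∣p-x∣ : ∀ {n} {p : Subset n} {x} → x ∈ p → ∣ p ∣ ≡ suc ∣ p - x ∣
∣p∣≡1+∣p-x∣ {p = inside ∷ p} here = cong (suc ∘ ∣_∣) (sym (p─⊥≡p p))
∣p∣≡1+∣p-x∣ {p = inside ∷ p} (there x∈p) = cong suc (∣p∣≡1+∣p-x∣ x∈p)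
∣p∣≡1+∣p-x∣ {p = outside ∷ p} (there x∈p) = ∣p∣≡1+∣p-x∣ x∈p

x∉p-x : ∀ {n} (p : Subset n) x → x ∉ p - x
x∉p-x (_ ∷ p) zero ()
x∉p-x (_ ∷ p) (suc x) (there x∈p-x) = x∉p-x p x x∈p-x

injection⇒∣p∣≤∣q∣ : ∀ {n} {p q : Subset n} (R : Fin n → Fin n → Set) →
                    (∀ {x} → x ∈ p → ∃ λ y → y ∈ q × R x y) →
                    (∀ {x x′ y} → x ∈ p → x′ ∈ p → R x y → R x′ y → x ≡ x′) →
                    ∣ p ∣ ≤ ∣ q ∣
injection⇒∣p∣≤∣q∣ {n} {p = p} R = go (⊂-wellFounded p)
  where
  go : ∀ {p q} → Acc _⊂_ p →
       (∀ {x} → x ∈ p → ∃ λ y → y ∈ q × R x y) →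
       (∀ {x x′ y} → x ∈ p → x′ ∈ p → R x y → R x′ y → x ≡ x′) →
       ∣ p ∣ ≤ ∣ q ∣
  go {p} {q} (acc rs) image injective with nonempty? p
  ... | no p-empty = subst (_≤ ∣ q ∣) (sym (trans (cong ∣_∣ (Empty-unique p-empty)) (∣⊥∣≡0 n))) z≤n
  ... | yes (x , x∈p) with image x∈p
  ...   | y , y∈q , Rxy = begin
    ∣ p ∣          ≡⟨ ∣p∣≡1+∣p-x∣ x∈p ⟩
    suc ∣ p - x ∣  ≤⟨ s≤s (go (rs (x∈p⇒p-x⊂p x∈p)) image′ (λ x′∈ x″∈ → injective (⊆p x′∈) (⊆p x″∈))) ⟩
    suc ∣ q - y ∣  ≡⟨ sym (∣p∣≡1+∣p-x∣ y∈q) ⟩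
    ∣ q ∣          ∎
    where
    open ≤-Reasoning
    ⊆p : ∀ {x′} → x′ ∈ p - x → x′ ∈ p
    ⊆p = p─q⊆p p _
    image′ : ∀ {x′} → x′ ∈ p - x → ∃ λ y′ → y′ ∈ q - y × R x′ y′
    image′ {x′} x′∈ with image (⊆p x′∈)
    ... | y′ , y′∈q , Rx′y′ = y′ , x∈p∧x≢y⇒x∈p-y y′∈q y′≢y , Rx′y′
      where
      y′≢y : y′ ≢ y
      y′≢y refl = x∉p-x p x (subst (_∈ p - x) (injective (⊆p x′∈) x∈p Rx′y′ Rxy) x′∈)

module _ {n : ℕ} where

  Undirected : (Fin n → Fin n → Set) → Graph
  Undirected S = record { size = n ; Adj = λ i j → S i j ⊎ S j i }

  jumped : Subset n → Fin n → Fin n → Fin n → Subset n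
  jumped D u v w = ((D [ u ]≔ outside) [ v ]≔ outside) [ w ]≔ inside

  ∈-≔⁻ : ∀ {p : Subset n} {i j s} → i ≢ j → i ∈ p [ j ]≔ s → i ∈ p
  ∈-≔⁻ {p} {i} i≢j i∈ = lookup⇒[]= i p (trans (sym (lookup∘update′ i≢j p _)) ([]=⇒lookup i∈))

  ∉-≔-outside : ∀ (p : Subset n) i → i ∉ p [ i ]≔ outside
  ∉-≔-outside p i i∈ with []=-injective i∈ ([]≔-updates p i)
  ... | ()

  ∈-jumped : ∀ {D u v w x} → x ∈ jumped D u v w → x ≡ w ⊎ (x ∈ D × x ≢ u × x ≢ v)
  ∈-jumped {D} {u} {v} {w} {x} x∈ with x ≟ w
  ... | yes x≡w = inj₁ x≡w
  ... | no x≢w with x ≟ v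
  ...   | yes refl = ⊥-elim (∉-≔-outside _ v (∈-≔⁻ x≢w x∈))
  ...   | no x≢v with x ≟ u
  ...     | yes refl = ⊥-elim (∉-≔-outside D u (∈-≔⁻ x≢v (∈-≔⁻ x≢w x∈)))
  ...     | no x≢u = inj₂ (∈-≔⁻ x≢u (∈-≔⁻ x≢v (∈-≔⁻ x≢w x∈)) , x≢u , x≢v)

  -- ChainTo S D x: for some k, the S-predecessors of x at distances 1, 3, …, 2k+1 and 2k+2
  -- all carry pegs, so that k+1 successive jumps along S can bring a peg to x.
  data ChainTo (S : Fin n → Fin n → Set) (D : Subset n) : Fin n → Set where
    chain : ∀ {a b x} → S a b → S b x → b ∈ D → a ∈ D ⊎ ChainTo S D a → ChainTo S D x

  Attainable : (Fin n → Fin n → Set) → Subset n → Fin n → Set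
  Attainable S D x = x ∈ D ⊎ ChainTo S D x ⊎ ChainTo (flip S) D x

  attainable-flip : ∀ {S D x} → Attainable (flip S) D x → Attainable S D x
  attainable-flip (inj₁ x∈) = inj₁ x∈
  attainable-flip (inj₂ (inj₁ c)) = inj₂ (inj₂ c)
  attainable-flip (inj₂ (inj₂ c)) = inj₂ (inj₁ c)

  attainable-extend : ∀ {S D a b x} → Deterministic _≡_ S →
                      S a b → S b x → b ∈ D → Attainable S D a → Attainable S D x
  attainable-extend det sab sbx b∈ (inj₁ a∈) = inj₂ (inj₁ (chain sab sbx b∈ (inj₁ a∈)))
  attainable-extend det sab sbx b∈ (inj₂ (inj₁ c)) = inj₂ (inj₁ (chain sab sbx b∈ (inj₂ c)))
  -- A backward chain into a begins with the peg at b and continues from x.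
  attainable-extend det sab sbx b∈ (inj₂ (inj₂ (chain sb′a′ sab′ _ rest))) with det sab′ sab
  ... | refl with det sb′a′ sbx
  ...   | refl = [ inj₁ , inj₂ ∘ inj₂ ]′ rest

  chain-predecessor : ∀ {S D x y x′} → Deterministic _≡_ (flip S) →
                      ChainTo S D x → S y x → S x′ y → x′ ∈ D ⊎ ChainTo S D x′
  chain-predecessor det⁻ (chain sab sbx _ rest) syx sx′y with det⁻ sbx syx
  ... | refl with det⁻ sab sx′y
  ...   | refl = rest

module JumpAlong {n} {S : Fin n → Fin n → Set}
                 (det : Deterministic _≡_ S) (det⁻ : Deterministic _≡_ (flip S))
                 {D : Subset n} {u v w : Fin n}
                 (suv : S u v) (svw : S v w) (u∈ : u ∈ D) (v∈ : v ∈ D) (w∉ : w ∉ D) where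

  private
    D′ : Subset n
    D′ = jumped D u v w

  u∉D′ : u ∉ D′
  u∉D′ u∈′ with ∈-jumped u∈′
  ... | inj₁ refl = w∉ u∈
  ... | inj₂ (_ , u≢u , _) = u≢u refl

  v∉D′ : v ∉ D′
  v∉D′ v∈′ with ∈-jumped v∈′
  ... | inj₁ refl = w∉ v∈
  ... | inj₂ (_ , _ , v≢v) = v≢v refl

  peg-before : ∀ {x} → x ∈ D′ → Attainable S D x
  peg-before x∈′ with ∈-jumped x∈′
  ... | inj₁ refl = inj₂ (inj₁ (chain suv svw v∈ (inj₁ u∈)))
  ... | inj₂ (x∈ , _) = inj₁ x∈

  ¬chain-through-v : ¬ (v ∈ D′ ⊎ ChainTo S D′ v)
  ¬chain-through-v (inj₁ v∈′) = v∉D′ v∈′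
  ¬chain-through-v (inj₂ (chain _ sbv b∈′ _)) with det⁻ sbv suv
  ... | refl = u∉D′ b∈′

  forward-before : ∀ {x} → ChainTo S D′ x → Attainable S D x
  forward-before (chain sab sbx b∈′ rest) with ∈-jumped b∈′
  ... | inj₁ refl with det⁻ sab svw
  ...   | refl = ⊥-elim (¬chain-through-v rest)
  forward-before (chain sab sbx b∈′ (inj₁ a∈′)) | inj₂ (b∈ , _) =
    attainable-extend det sab sbx b∈ (peg-before a∈′)
  forward-before (chain sab sbx b∈′ (inj₂ c)) | inj₂ (b∈ , _) =
    attainable-extend det sab sbx b∈ (forward-before c)

  backward-before : ∀ {x} → ChainTo (flip S) D′ x → Attainable S D x
  backward-before (chain sba sxb b∈′ rest) with ∈-jumped b∈′
  ... | inj₁ refl with det⁻ sxb svw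
  ...   | refl = inj₁ v∈
  backward-before (chain sba sxb b∈′ (inj₁ a∈′)) | inj₂ (b∈ , _) =
    attainable-flip (attainable-extend det⁻ sba sxb b∈ (attainable-flip (peg-before a∈′)))
  backward-before (chain sba sxb b∈′ (inj₂ c)) | inj₂ (b∈ , _) =
    attainable-flip (attainable-extend det⁻ sba sxb b∈ (attainable-flip (backward-before c)))

  attainable-before : ∀ {x} → Attainable S D′ x → Attainable S D x
  attainable-before (inj₁ x∈′) = peg-before x∈′
  attainable-before (inj₂ (inj₁ c)) = forward-before c
  attainable-before (inj₂ (inj₂ c)) = backward-before c

module _ {n} {S : Fin n → Fin n → Set}
         (det : Deterministic _≡_ S) (det⁻ : Deterministic _≡_ (flip S)) where

  attainable-move : ∀ {D D′ x} → PegMove (Undirected S) D D′ → Attainable S D′ x → Attainable S D x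
  attainable-move (jump u v w u∈ v∈ _ (inj₁ suv) w∉ (inj₁ svw)) =
    JumpAlong.attainable-before det det⁻ suv svw u∈ v∈ w∉
  attainable-move (jump u v w u∈ v∈ _ (inj₂ svu) w∉ (inj₂ swv)) =
    attainable-flip ∘ JumpAlong.attainable-before det⁻ det svu swv u∈ v∈ w∉ ∘ attainable-flip
  attainable-move (jump u v w u∈ v∈ _ (inj₁ suv) w∉ (inj₂ swv)) with det⁻ suv swv
  ... | refl = ⊥-elim (w∉ u∈)
  attainable-move (jump u v w u∈ v∈ _ (inj₂ svu) w∉ (inj₁ svw)) with det svu svw
  ... | refl = ⊥-elim (w∉ u∈)

  attainable-moves : ∀ {D D′ x} → PegMoves (Undirected S) D D′ → Attainable S D′ x → Attainable S D x
  attainable-moves ε = id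
  attainable-moves (m ◅ ms) = attainable-move m ∘ attainable-moves ms

  reachable⇒attainable : ∀ {D x} → Reachable (Undirected S) D x → Attainable S D x
  reachable⇒attainable (_ , ms , x∈) = attainable-moves ms (inj₁ x∈)

  module _ {D : Subset n} (attainable : ∀ x → Attainable S D x) where

    Partner : Fin n → Fin n → Set
    Partner x y = ChainTo S D x × S y x ⊎ ¬ ChainTo S D x × S x y

    partner : ∀ {x} → x ∉ D → Dec (ChainTo S D x) → ∃ λ y → y ∈ D × Partner x y
    partner _ (yes c@(chain _ sbx b∈ _)) = _ , b∈ , inj₁ (c , sbx)
    partner {x} x∉ (no ¬c) with attainable x
    ... | inj₁ x∈ = contradiction x∈ x∉
    ... | inj₂ (inj₁ c) = contradiction c ¬c
    ... | inj₂ (inj₂ (chain _ sxb b∈ _)) = _ , b∈ , inj₂ (¬c , sxb)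

    partner-injective : ∀ {x x′ y} → x ∉ D → x′ ∉ D → Partner x y → Partner x′ y → x ≡ x′
    partner-injective _ _ (inj₁ (_ , syx)) (inj₁ (_ , syx′)) = det syx syx′
    partner-injective _ _ (inj₂ (_ , sxy)) (inj₂ (_ , sx′y)) = det⁻ sxy sx′y
    -- In the mixed cases the chain into one hole would pass through the other.
    partner-injective _ x′∉ (inj₁ (c , syx)) (inj₂ (¬c′ , sx′y)) =
      ⊥-elim ([ x′∉ , ¬c′ ]′ (chain-predecessor det⁻ c syx sx′y))
    partner-injective x∉ _ (inj₂ (¬c , sxy)) (inj₁ (c′ , syx′)) =
      ⊥-elim ([ x∉ , ¬c ]′ (chain-predecessor det⁻ c′ syx′ sxy))

    holes≤pegs : (∀ x → Dec (ChainTo S D x)) → ∣ ∁ D ∣ ≤ ∣ D ∣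
    holes≤pegs chain? = injection⇒∣p∣≤∣q∣ Partner
      (λ x∈∁D → partner (x∈∁p⇒x∉p x∈∁D) (chain? _))
      (λ x∈∁D x′∈∁D → partner-injective (x∈∁p⇒x∉p x∈∁D) (x∈∁p⇒x∉p x′∈∁D))

    -- ChainTo need not be decidable, but the goal is a decidable inequality, so we may
    -- decide it classically at each of the finitely many vertices.
    n≤∣D∣+∣D∣ : n ≤ ∣ D ∣ + ∣ D ∣
    n≤∣D∣+∣D∣ = decidable-stable (n ≤? ∣ D ∣ + ∣ D ∣)
      (¬¬-map (∣∁D∣≤∣D∣⇒n≤∣D∣+∣D∣ ∘ holes≤pegs)
              (sequence (RawMonad.rawApplicative ¬¬-Monad) (λ _ → ¬¬-excluded-middle)))
      where
      open ≤-Reasoning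
      ∣∁D∣≤∣D∣⇒n≤∣D∣+∣D∣ : ∣ ∁ D ∣ ≤ ∣ D ∣ → n ≤ ∣ D ∣ + ∣ D ∣
      ∣∁D∣≤∣D∣⇒n≤∣D∣+∣D∣ ∣∁D∣≤∣D∣ = begin
        n                    ≤⟨ m≤n+m∸n n ∣ D ∣ ⟩
        ∣ D ∣ + (n ∸ ∣ D ∣)  ≡⟨ cong (∣ D ∣ +_) (sym (∣∁p∣≡n∸∣p∣ D)) ⟩
        ∣ D ∣ + ∣ ∁ D ∣      ≤⟨ +-monoʳ-≤ ∣ D ∣ ∣∁D∣≤∣D∣ ⟩
        ∣ D ∣ + ∣ D ∣        ∎

CycSucc-deterministic : ∀ {n} → Deterministic _≡_ (CycSucc n)
CycSucc-deterministic (inj₁ j≡1+i) (inj₁ j′≡1+i) = Fin.toℕ-injective (trans j≡1+i (sym j′≡1+i))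
CycSucc-deterministic {y = j} (inj₁ j≡1+i) (inj₂ (1+i≡n , _)) =
  contradiction (toℕ<n j) (<-irrefl (trans j≡1+i 1+i≡n))
CycSucc-deterministic {z = j′} (inj₂ (1+i≡n , _)) (inj₁ j′≡1+i) =
  contradiction (toℕ<n j′) (<-irrefl (trans j′≡1+i 1+i≡n))
CycSucc-deterministic (inj₂ (_ , j≡0)) (inj₂ (_ , j′≡0)) = Fin.toℕ-injective (trans j≡0 (sym j′≡0))

CycSucc⁻¹-deterministic : ∀ {n} → Deterministic _≡_ (flip (CycSucc n))
CycSucc⁻¹-deterministic (inj₁ j≡1+i) (inj₁ j≡1+i′) =
  Fin.toℕ-injective (suc-injective (trans (sym j≡1+i) j≡1+i′))
CycSucc⁻¹-deterministic (inj₁ j≡1+i) (inj₂ (_ , j≡0)) = contradiction (trans (sym j≡1+i) j≡0) λ ()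
CycSucc⁻¹-deterministic (inj₂ (_ , j≡0)) (inj₁ j≡1+i′) = contradiction (trans (sym j≡1+i′) j≡0) λ ()
CycSucc⁻¹-deterministic (inj₂ (1+i≡n , _)) (inj₂ (1+i′≡n , _)) =
  Fin.toℕ-injective (suc-injective (trans 1+i≡n (sym 1+i′≡n)))

cycle-lower-bound : ∀ {n d} → Solvable (Cycle n) d → ⌈ n /2⌉ ≤ d
cycle-lower-bound {n} (D , refl , reachesAll) = begin
  ⌈ n /2⌉                ≤⟨ ⌈n/2⌉-mono (n≤∣D∣+∣D∣ CycSucc-deterministic CycSucc⁻¹-deterministic attainable) ⟩
  ⌈ ∣ D ∣ + ∣ D ∣ /2⌉    ≡⟨ sym (n≡⌈n+n/2⌉ ∣ D ∣) ⟩
  ∣ D ∣                  ∎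
  where
  open ≤-Reasoning
  attainable : ∀ x → Attainable (CycSucc n) D x
  attainable x = reachable⇒attainable CycSucc-deterministic CycSucc⁻¹-deterministic (reachesAll x)

data Even : ℕ → Set where
  zero : Even zero
  2+_  : ∀ {k} → Even k → Even (suc (suc k))

even-or-odd : ∀ k → Even k ⊎ Even (suc k)
even-or-odd zero = inj₁ zero
even-or-odd (suc k) with even-or-odd k
... | inj₁ e = inj₂ (2+ e)
... | inj₂ o = inj₁ o

alternating : (k : ℕ) → Subset k
alternating zero = []
alternating (suc zero) = outside ∷ []
alternating (suc (suc k)) = inside ∷ outside ∷ alternating k

∣alternating∣ : ∀ k → ∣ alternating k ∣ ≡ ⌊ k /2⌋
∣alternating∣ zero = refl
∣alternating∣ (suc zero) = refl
∣alternating∣ (suc (suc k)) = cong suc (∣alternating∣ k)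

alternating-inside : ∀ {k t} (i : Fin k) → toℕ i ≡ t → Even t → suc t < k →
                     lookup (alternating k) i ≡ inside
alternating-inside {suc zero} zero refl zero (s≤s ())
alternating-inside {suc (suc k)} zero refl zero _ = refl
alternating-inside {suc (suc k)} (suc (suc i)) refl (2+ e) (s≤s (s≤s lt)) =
  alternating-inside i refl e lt

alternating-outside : ∀ {k} (i : Fin k) → Even (suc (toℕ i)) → lookup (alternating k) i ≡ outside
alternating-outside {suc (suc k)} (suc zero) _ = refl
alternating-outside {suc (suc k)} (suc (suc i)) (2+ e) = alternating-outside i e

alternating-last : ∀ {k} (i : Fin k) → suc (toℕ i) ≡ k → lookup (alternating k) i ≡ outside
alternating-last {suc zero} zero _ = refl
alternating-last {suc (suc k)} (suc zero) _ = refl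
alternating-last {suc (suc k)} (suc (suc i)) i≡last =
  alternating-last i (suc-injective (suc-injective i≡last))

lookup≡outside⇒∉ : ∀ {n} {p : Subset n} {i} → lookup p i ≡ outside → i ∉ p
lookup≡outside⇒∉ p[i]≡outside i∈p with trans (sym ([]=⇒lookup i∈p)) p[i]≡outside
... | ()

module _ {n} (D₀ : Subset n) where

  Swept : Fin n → Set
  Swept t = ∃ λ D → PegMoves (Cycle n) D₀ D × t ∈ D ×
                    (∀ i → toℕ t < toℕ i → lookup D i ≡ lookup D₀ i)

  swept⇒reachable : ∀ {t} → Swept t → Reachable (Cycle n) D₀ t
  swept⇒reachable (D , moves , t∈ , _) = D , moves , t∈

  advance : ∀ {u v w} → toℕ v ≡ suc (toℕ u) → toℕ w ≡ suc (toℕ v) →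
            lookup D₀ v ≡ inside → lookup D₀ w ≡ outside → Swept u → Swept w
  advance {u} {v} {w} v≡1+u w≡1+v v-peg w-hole (D , moves , u∈ , agree) =
    jumped D u v w , moves ◅◅ (jump-uvw ◅ ε) , []≔-updates _ w , agree′
    where
    u<v : toℕ u < toℕ v
    u<v = ≤-reflexive (sym v≡1+u)
    v<w : toℕ v < toℕ w
    v<w = ≤-reflexive (sym w≡1+v)
    jump-uvw : PegMove (Cycle n) D (jumped D u v w)
    jump-uvw = jump u v w u∈ (lookup⇒[]= v D (trans (agree v u<v) v-peg))
                    (Fin.<⇒≢ u<v) (inj₁ (inj₁ v≡1+u))
                    (lookup≡outside⇒∉ (trans (agree w (Fin.<-trans u<v v<w)) w-hole)) (inj₁ (inj₁ w≡1+v))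
    agree′ : ∀ i → toℕ w < toℕ i → lookup (jumped D u v w) i ≡ lookup D₀ i
    agree′ i w<i = begin
      lookup (((D [ u ]≔ outside) [ v ]≔ outside) [ w ]≔ inside) i
        ≡⟨ lookup∘update′ (≢-sym (Fin.<⇒≢ w<i)) ((D [ u ]≔ outside) [ v ]≔ outside) inside ⟩
      lookup ((D [ u ]≔ outside) [ v ]≔ outside) i
        ≡⟨ lookup∘update′ (≢-sym (Fin.<⇒≢ v<i)) (D [ u ]≔ outside) outside ⟩
      lookup (D [ u ]≔ outside) i
        ≡⟨ lookup∘update′ (≢-sym (Fin.<⇒≢ u<i)) D outside ⟩
      lookup D i
        ≡⟨ agree i u<i ⟩
      lookup D₀ i
        ∎
      where
      open ≡-Reasoning
      v<i = Fin.<-trans v<w w<i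
      u<i = Fin.<-trans u<v v<i

module _ (k : ℕ) where

  D₀ : Subset (3 + k)
  D₀ = inside ∷ alternating (2 + k)

  ∣D₀∣ : ∣ D₀ ∣ ≡ ⌈ 3 + k /2⌉
  ∣D₀∣ = cong suc (∣alternating∣ (2 + k))

  sweep : ∀ {t} → Even t → (w : Fin (3 + k)) → toℕ w ≡ t → Swept D₀ w
  sweep zero zero refl = D₀ , ε , here , λ _ _ → refl
  sweep (2+ e) (suc (suc w)) refl =
    advance D₀ {u} {v} v≡1+u w≡1+v
      (alternating-inside (inject₁ w) (toℕ-inject₁ w) e (s≤s (toℕ<n w)))
      (alternating-outside (suc w) (2+ e))
      (sweep e u (trans (toℕ-inject₁ (inject₁ w)) (toℕ-inject₁ w)))
    where
    u = inject₁ (inject₁ w)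
    v = suc (inject₁ w)
    v≡1+u : toℕ v ≡ suc (toℕ u)
    v≡1+u = cong suc (sym (toℕ-inject₁ (inject₁ w)))
    w≡1+v : suc (suc (toℕ w)) ≡ suc (toℕ v)
    w≡1+v = cong (2 +_) (sym (toℕ-inject₁ w))

  last-reachable : ∀ (t : Fin (3 + k)) → suc (toℕ t) ≡ 3 + k → Reachable (Cycle (3 + k)) D₀ t
  last-reachable (suc t) t≡last = jumped D₀ (suc zero) zero (suc t) , jump-1-over-0 ◅ ε ,
                                  []≔-updates ((D₀ [ suc zero ]≔ outside) [ zero ]≔ outside) (suc t)
    where
    jump-1-over-0 : PegMove (Cycle (3 + k)) D₀ (jumped D₀ (suc zero) zero (suc t))
    jump-1-over-0 = jump (suc zero) zero (suc t) (there here) here (λ ()) (inj₂ (inj₁ refl))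
                         (lookup≡outside⇒∉ (alternating-last t (suc-injective t≡last)))
                         (inj₂ (inj₂ (t≡last , refl)))

  reaches-all : ReachesAll (Cycle (3 + k)) D₀
  reaches-all t with even-or-odd (toℕ t)
  reaches-all t | inj₁ e = swept⇒reachable D₀ (sweep e t refl)
  reaches-all (suc t) | inj₂ (2+ e) with suc (suc (toℕ t)) <? 3 + k
  ... | yes lt = D₀ , ε , lookup⇒[]= (suc t) D₀ (alternating-inside t refl e (≤-pred lt))
  ... | no ¬lt = last-reachable (suc t) (≤-antisym (toℕ<n (suc t)) (≮⇒≥ ¬lt))

  cycle-solvable : Solvable (Cycle (3 + k)) ⌈ 3 + k /2⌉
  cycle-solvable = D₀ , ∣D₀∣ , reaches-all

theorem3p2 : (n : ℕ) → n ≥ 3 → OptimalPeggingNumber (Cycle n) ⌈ n /2⌉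
theorem3p2 (suc (suc (suc k))) (s≤s (s≤s (s≤s z≤n))) =
  s≤s z≤n , cycle-solvable k , λ d _ d<⌈n/2⌉ solvable → <⇒≱ d<⌈n/2⌉ (cycle-lower-bound solvable)
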